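{- Let $\Phi$ be an $\mathcal{ALCQIO}_{b,Re}$-formula with reachability assertions $Reach(B_{h'},S_{h'},A_{h'})$, $1\le h'\le h$, let $\mathcal M$ be a structure, fix $h'$, and let $f$ be an $h'$-useful labeling for $\mathcal M$. Then $\mathit{val}_f(D_{h'}^{\mathcal M})=0$ iff every vertex of $D_{h'}^{\mathcal M}$ is reachable from a vertex of $B_{h'}^{\mathcal M}$.
   Context: Setting: $\Phi=\varphi\land\bigwedge RE\land\bigwedge DI$ with $\varphi$ a Boolean combination of concept inclusions in description logic $\mathcal{ALCQIO}_b$ (concepts from atomic concepts and nominals via $\sqcap,\sqcup,\neg,\exists r.C,\exists^{\le n}r.C$, $r$ an atomic role or inverse), $RE$ a finite set of assertions $Reach(B,S,A)$ ($A,B$ atomic concepts, $S$ a set of functional roles), $DI$ a set of concept disjointness statements. Structures are finite. $D^{\mathcal M}_{h'}$ is the directed graph with vertex set $A_{h'}^{\mathcal M}$ and edges $\left(\bigcup_{s\in S_{h'}}s^{\mathcal M}\right)\cap(A_{h'}^{\mathcal M})^2$. $C\in\varphi$ means $C$ is a concept occurring as a side of an inclusion in $\varphi$; $\mathrm{TYPES}_\varphi$ is the power set of $\{C:C\in\varphi\}$; the type of $u$ is the set of $C\in\varphi$ containing $u$. A function $f:A_{h'}^{\mathcal M}\to\{1,\dots,|\mathrm{TYPES}_\varphi|\}$ is an $h'$-useful labeling if (1) equal labels imply equal types and (2) every $u\in A_{h'}^{\mathcal M}\setminus B_{h'}^{\mathcal M}$ admits $v,w\in A_{h'}^{\mathcal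 M}$ with $f(u)=f(v)$, $f(w)<f(v)$ and $(w,v)$ an edge of $D_{h'}^{\mathcal M}$. A set $X\subseteq A_{h'}^{\mathcal M}$ is a base for $D_{h'}^{\mathcal M}$ if every vertex of $D_{h'}^{\mathcal M}$ is reachable from some element of $X$; $\mathit{val}_f(X)=\sum_{x\in X\setminus B_{h'}^{\mathcal M}}f(x)$ and $\mathit{val}_f(D_{h'}^{\mathcal M})=\min\{\mathit{val}_f(X):X\text{ a base for }D_{h'}^{\mathcal M}\}$. -}

module Defs where

open import Data.Nat as ℕ using (ℕ; _≤_; _<_; _^_; _+_)
open import Data.Bool using (Bool; true; false; _∧_; _∨_; not; if_then_else_)
open import Data.Fin using (Fin)
open import Data.List using (List; []; _∷_; _++_; length; map; deduplicate)
open import Data.Bool.ListAction using (any)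
open import Data.Nat.ListAction using (sum)
open import Data.List.Base using (allFin)
open import Data.List.Membership.Propositional using (_∈_)
open import Data.Fin.Subset using (Subset; _∉_) renaming (_∈_ to _∈ₛ_)
open import Data.Fin.Subset.Properties using (_∈?_)
open import Data.Product using (Σ; ∃; _×_; _,_)
open import Relation.Nullary using (Dec; yes; no; ¬_)
open import Relation.Binary.PropositionalEquality using (_≡_; refl)
open import Relation.Binary.Construct.Closure.ReflexiveTransitive using (Star)

data Role : Set where
  rn  : ℕ → Role
  inv : ℕ → Role

infixl 7 _⊓_
infixl 6 _⊔_

data Concept : Set where
  atom : ℕ → Concept
  nomC : ℕ → Concept
  _⊓_  : Concept → Concept → Concept
  _⊔_  : Concept → Concept → Concept
  ¬c   : Concept → Concept
  ∃r   : Role → Concept → Concept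
  ≤r   : ℕ → Role → Concept → Concept

data Formula : Set where
  incl : Concept → Concept → Formula
  _∧f_ : Formula → Formula → Formula
  _∨f_ : Formula → Formula → Formula
  ¬f   : Formula → Formula

-- the concepts C ∈ φ : those occurring as a side of an inclusion
sides : Formula → List Concept
sides (incl C D) = C ∷ D ∷ []
sides (φ ∧f ψ)   = sides φ ++ sides ψ
sides (φ ∨f ψ)   = sides φ ++ sides ψ
sides (¬f φ)     = sides φ

-- Reach(B, S, A): B, A atomic concept names, S a set (list) of functional role names
record ReachAssertion : Set where
  constructor Reach
  field
    B : ℕ
    S : List ℕ
    A : ℕ

-- Φ = φ ∧ ⋀ RE ∧ ⋀ DI ; a disjointness statement is a list of concepts
-- declared pairwise disjoint.
record ALCQIObRe : Set where
  field
    φ  : Formula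
    RE : List ReachAssertion
    DI : List (List Concept)

_≟R_ : (r s : Role) → Dec (r ≡ s)
rn a ≟R rn b with a ℕ.≟ b
... | yes refl = yes refl
... | no ne = no λ { refl → ne refl }
inv a ≟R inv b with a ℕ.≟ b
... | yes refl = yes refl
... | no ne = no λ { refl → ne refl }
rn _ ≟R inv _ = no λ ()
inv _ ≟R rn _ = no λ ()

_≟C_ : (C D : Concept) → Dec (C ≡ D)
(atom x0) ≟C (atom y0) with ℕ._≟_ x0 y0
... | yes refl = yes refl
... | no ne = no λ { refl → ne refl }
(atom _) ≟C (nomC _) = no λ ()
(atom _) ≟C (_ ⊓ _) = no λ ()
(atom _) ≟C (_ ⊔ _) = no λ ()
(atom _) ≟C (¬c _) = no λ ()
(atom _) ≟C (∃r _ _) = no λ ()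
(atom _) ≟C (≤r _ _ _) = no λ ()
(nomC x0) ≟C (nomC y0) with ℕ._≟_ x0 y0
... | yes refl = yes refl
... | no ne = no λ { refl → ne refl }
(nomC _) ≟C (atom _) = no λ ()
(nomC _) ≟C (_ ⊓ _) = no λ ()
(nomC _) ≟C (_ ⊔ _) = no λ ()
(nomC _) ≟C (¬c _) = no λ ()
(nomC _) ≟C (∃r _ _) = no λ ()
(nomC _) ≟C (≤r _ _ _) = no λ ()
(x0 ⊓ x1) ≟C (y0 ⊓ y1) with _≟C_ x0 y0 | _≟C_ x1 y1
... | yes refl | yes refl = yes refl
... | no ne | _ = no λ { refl → ne refl }
... | _ | no ne = no λ { refl → ne refl }
(_ ⊓ _) ≟C (atom _) = no λ ()
(_ ⊓ _) ≟C (nomC _) = no λ ()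
(_ ⊓ _) ≟C (_ ⊔ _) = no λ ()
(_ ⊓ _) ≟C (¬c _) = no λ ()
(_ ⊓ _) ≟C (∃r _ _) = no λ ()
(_ ⊓ _) ≟C (≤r _ _ _) = no λ ()
(x0 ⊔ x1) ≟C (y0 ⊔ y1) with _≟C_ x0 y0 | _≟C_ x1 y1
... | yes refl | yes refl = yes refl
... | no ne | _ = no λ { refl → ne refl }
... | _ | no ne = no λ { refl → ne refl }
(_ ⊔ _) ≟C (atom _) = no λ ()
(_ ⊔ _) ≟C (nomC _) = no λ ()
(_ ⊔ _) ≟C (_ ⊓ _) = no λ ()
(_ ⊔ _) ≟C (¬c _) = no λ ()
(_ ⊔ _) ≟C (∃r _ _) = no λ ()
(_ ⊔ _) ≟C (≤r _ _ _) = no λ ()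
(¬c x0) ≟C (¬c y0) with _≟C_ x0 y0
... | yes refl = yes refl
... | no ne = no λ { refl → ne refl }
(¬c _) ≟C (atom _) = no λ ()
(¬c _) ≟C (nomC _) = no λ ()
(¬c _) ≟C (_ ⊓ _) = no λ ()
(¬c _) ≟C (_ ⊔ _) = no λ ()
(¬c _) ≟C (∃r _ _) = no λ ()
(¬c _) ≟C (≤r _ _ _) = no λ ()
(∃r x0 x1) ≟C (∃r y0 y1) with _≟R_ x0 y0 | _≟C_ x1 y1
... | yes refl | yes refl = yes refl
... | no ne | _ = no λ { refl → ne refl }
... | _ | no ne = no λ { refl → ne refl }
(∃r _ _) ≟C (atom _) = no λ ()
(∃r _ _) ≟C (nomC _) = no λ ()
(∃r _ _) ≟C (_ ⊓ _) = no λ ()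
(∃r _ _) ≟C (_ ⊔ _) = no λ ()
(∃r _ _) ≟C (¬c _) = no λ ()
(∃r _ _) ≟C (≤r _ _ _) = no λ ()
(≤r x0 x1 x2) ≟C (≤r y0 y1 y2) with ℕ._≟_ x0 y0 | _≟R_ x1 y1 | _≟C_ x2 y2
... | yes refl | yes refl | yes refl = yes refl
... | no ne | _ | _ = no λ { refl → ne refl }
... | _ | no ne | _ = no λ { refl → ne refl }
... | _ | _ | no ne = no λ { refl → ne refl }
(≤r _ _ _) ≟C (atom _) = no λ ()
(≤r _ _ _) ≟C (nomC _) = no λ ()
(≤r _ _ _) ≟C (_ ⊓ _) = no λ ()
(≤r _ _ _) ≟C (_ ⊔ _) = no λ ()
(≤r _ _ _) ≟C (¬c _) = no λ ()
(≤r _ _ _) ≟C (∃r _ _) = no λ ()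

-- |TYPES_φ| = 2 ^ (number of distinct concepts C ∈ φ)
numTypes : Formula → ℕ
numTypes φ = 2 ^ length (deduplicate _≟C_ (sides φ))

record Structure : Set where
  field
    size : ℕ
    conc : ℕ → Fin size → Bool
    role : ℕ → Fin size → Fin size → Bool
    nomi : ℕ → Fin size

module _ (M : Structure) where
  open Structure M

  roleI : Role → Fin size → Fin size → Bool
  roleI (rn r)  u v = role r u v
  roleI (inv r) u v = role r v u

  countTrue : List Bool → ℕ
  countTrue []          = 0
  countTrue (true ∷ bs) = ℕ.suc (countTrue bs)
  countTrue (false ∷ bs) = countTrue bs

  ⟦_⟧ : Concept → Fin size → Bool
  ⟦ atom a ⟧ u = conc a u
  ⟦ nomC o ⟧ u with nomi o Data.Fin.≟ u
  ... | yes _ = true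
  ... | no _  = false
  ⟦ C ⊓ D ⟧ u = ⟦ C ⟧ u ∧ ⟦ D ⟧ u
  ⟦ C ⊔ D ⟧ u = ⟦ C ⟧ u ∨ ⟦ D ⟧ u
  ⟦ ¬c C ⟧ u = not (⟦ C ⟧ u)
  ⟦ ∃r r C ⟧ u = any (λ v → roleI r u v ∧ ⟦ C ⟧ v) (allFin size)
  ⟦ ≤r k r C ⟧ u with countTrue (map (λ v → roleI r u v ∧ ⟦ C ⟧ v) (allFin size)) ℕ.≤? k
  ... | yes _ = true
  ... | no _  = false

  SameType : Formula → Fin size → Fin size → Set
  SameType φ u v = ∀ C → C ∈ sides φ → ⟦ C ⟧ u ≡ ⟦ C ⟧ v

  module _ (ra : ReachAssertion) where
    open ReachAssertion ra

    Vertex : Fin size → Set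
    Vertex u = conc A u ≡ true

    InB : Fin size → Set
    InB u = conc B u ≡ true

    Edge : Fin size → Fin size → Set
    Edge w v = Vertex w × Vertex v × Σ ℕ (λ s → s ∈ S × role s w v ≡ true)

    Reachable : Fin size → Fin size → Set
    Reachable x v = Vertex x × Star Edge x v

    -- h'-useful labeling (f is only relevant on A^M)
    record UsefulLabeling (φ : Formula) (f : Fin size → ℕ) : Set where
      field
        range  : ∀ u → Vertex u → 1 ≤ f u × f u ≤ numTypes φ
        types  : ∀ u v → Vertex u → Vertex v → f u ≡ f v → SameType φ u v
        useful : ∀ u → Vertex u → ¬ InB u →
                 Σ (Fin size) λ v → Σ (Fin size) λ w →
                   Vertex v × Vertex w × f u ≡ f v × f w < f v × Edge w v

    IsBase : Subset size → Set
    IsBase X = (∀ x → x ∈ₛ X → Vertex x) ×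
               (∀ v → Vertex v → Σ (Fin size) λ x → x ∈ₛ X × Reachable x v)

    val : (Fin size → ℕ) → Subset size → ℕ
    val f X = sum (map term (allFin size))
      where
        term : Fin size → ℕ
        term x with x ∈? X
        ... | no _ = 0
        ... | yes _ = if conc B x then 0 else f x

    -- val_f(D) = k : k is the minimum of val_f over all bases
    ValD≡ : (Fin size → ℕ) → ℕ → Set
    ValD≡ f k = (Σ (Subset size) λ X → IsBase X × val f X ≡ k) ×
                (∀ X → IsBase X → k ≤ val f X)

-- A base X ⊆ A then has value 0
-- exactly when X ⊆ B, so val_f(D) = 0 forces every vertex to be reachable
-- from B; conversely, if every vertex is reachable from B, then A ∩ B is a
-- base of value 0.
module Submission where

open import Defs
open import Data.Bool using (Bool; true; false; _∧_)
open import Data.Bool.Properties using () renaming (_≟_ to _≟ᵇ_)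
open import Data.Empty using (⊥-elim)
open import Data.Fin using (Fin)
open import Data.Fin.Subset using (Subset) renaming (_∈_ to _∈ₛ_)
open import Data.Fin.Subset.Properties using (_∈?_)
open import Data.List using ([]; _∷_; length; map; allFin)
open import Data.List.Base using (lookup)
open import Data.List.Membership.Propositional using (_∈_)
open import Data.List.Membership.Propositional.Properties using (∈-allFin)
open import Data.List.Relation.Unary.Any using (here; there)
open import Data.Nat using (ℕ; _+_; _≤_; z≤n)
open import Data.Nat.ListAction using (sum)
open import Data.Nat.Properties using (m+n≡0⇒m≡0; m+n≡0⇒n≡0; n>0⇒n≢0)
open import Data.Product using (Σ; _×_; _,_; proj₁; proj₂)
open import Data.Vec using (tabulate)
open import Data.Vec.Properties using (lookup∘tabulate; []=⇒lookup; lookup⇒[]=)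
open import Function using (_∘_)
open import Function.Bundles using (_⇔_; mk⇔; Equivalence)
open import Function.Construct.Composition using (_⇔-∘_)
open import Relation.Nullary using (yes; no; ¬_)
open import Relation.Binary.PropositionalEquality using (_≡_; refl; sym; trans; cong₂)

open Equivalence using (to; from)

∧≡true⇔ : ∀ {a b} → a ∧ b ≡ true ⇔ (a ≡ true × b ≡ true)
∧≡true⇔ {true}  = mk⇔ (λ b≡true → refl , b≡true) proj₂
∧≡true⇔ {false} = mk⇔ (λ ()) proj₁

∈-tabulate⇔ : ∀ {n} (p : Fin n → Bool) x → x ∈ₛ tabulate p ⇔ p x ≡ true
∈-tabulate⇔ p x = mk⇔
  (λ x∈ → trans (sym (lookup∘tabulate p x)) ([]=⇒lookup x∈))
  (λ px → lookup⇒[]= x (tabulate p) (trans (lookup∘tabulate p x) px))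

sum-map-≡0⇔ : ∀ {A : Set} (g : A → ℕ) xs → sum (map g xs) ≡ 0 ⇔ (∀ {x} → x ∈ xs → g x ≡ 0)
sum-map-≡0⇔ g []       = mk⇔ (λ _ ()) (λ _ → refl)
sum-map-≡0⇔ g (y ∷ ys) = mk⇔ to′ from′
  where
    to′ : g y + sum (map g ys) ≡ 0 → ∀ {x} → x ∈ y ∷ ys → g x ≡ 0
    to′ eq (here refl)  = m+n≡0⇒m≡0 (g y) eq
    to′ eq (there x∈ys) = to (sum-map-≡0⇔ g ys) (m+n≡0⇒n≡0 (g y) eq) x∈ys

    from′ : (∀ {x} → x ∈ y ∷ ys → g x ≡ 0) → g y + sum (map g ys) ≡ 0
    from′ h = cong₂ _+_ (h (here refl)) (from (sum-map-≡0⇔ g ys) (h ∘ there))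

-- The summand of `val` is local to its where-block; unifying against
-- `val f X` recovers it as a named function.
summandOf : ∀ {n} {g : Fin n → ℕ} → sum (map g (allFin n)) ≡ sum (map g (allFin n)) → Fin n → ℕ
summandOf {g = g} _ = g

module _ (M : Structure) (ra : ReachAssertion) where
  open Structure M
  open ReachAssertion ra

  ReachableFromB : Set
  ReachableFromB = ∀ v → Vertex M ra v → Σ (Fin size) λ b → InB M ra b × Reachable M ra b v

  summand : (Fin size → ℕ) → Subset size → Fin size → ℕ
  summand f X = summandOf (refl {x = val M ra f X})

  summand≡0⇔ : ∀ f X x → summand f X x ≡ 0 ⇔ (x ∈ₛ X → ¬ InB M ra x → f x ≡ 0)
  summand≡0⇔ f X x with x ∈? X
  ... | no x∉X = mk⇔ (λ _ x∈X → ⊥-elim (x∉X x∈X)) (λ _ → refl)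
  ... | yes x∈X with conc B x
  ...   | true  = mk⇔ (λ _ _ x∉B → ⊥-elim (x∉B refl)) (λ _ → refl)
  ...   | false = mk⇔ (λ fx≡0 _ _ → fx≡0) (λ h → h x∈X λ ())

  val≡0⇔ : ∀ f X → val M ra f X ≡ 0 ⇔ (∀ x → x ∈ₛ X → ¬ InB M ra x → f x ≡ 0)
  val≡0⇔ f X = mk⇔
    (λ val≡0 x → to (summand≡0⇔ f X x) (to sum≡0⇔ val≡0 (∈-allFin x)))
    (λ h → from sum≡0⇔ λ {x} _ → from (summand≡0⇔ f X x) (h x))
    where
      sum≡0⇔ : val M ra f X ≡ 0 ⇔ (∀ {x} → x ∈ allFin size → summand f X x ≡ 0)
      sum≡0⇔ = sum-map-≡0⇔ (summand f X) (allFin size)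

  val-⊆B≡0 : ∀ f X → (∀ x → x ∈ₛ X → InB M ra x) → val M ra f X ≡ 0
  val-⊆B≡0 f X X⊆B = from (val≡0⇔ f X) λ x x∈X x∉B → ⊥-elim (x∉B (X⊆B x x∈X))

  val≡0⇒⊆B : ∀ f X → (∀ u → Vertex M ra u → 1 ≤ f u) → (∀ x → x ∈ₛ X → Vertex M ra x) →
             val M ra f X ≡ 0 → ∀ x → x ∈ₛ X → InB M ra x
  val≡0⇒⊆B f X f-positive X⊆A val≡0 x x∈X with conc B x ≟ᵇ true
  ... | yes x∈B = x∈B
  ... | no x∉B  = ⊥-elim (n>0⇒n≢0 (f-positive x (X⊆A x x∈X)) (to (val≡0⇔ f X) val≡0 x x∈X x∉B))

  A∩B : Subset size
  A∩B = tabulate λ x → conc A x ∧ conc B x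

  ∈-A∩B⇔ : ∀ x → x ∈ₛ A∩B ⇔ (Vertex M ra x × InB M ra x)
  ∈-A∩B⇔ x = ∧≡true⇔ ⇔-∘ ∈-tabulate⇔ (λ x → conc A x ∧ conc B x) x

  A∩B-isBase : ReachableFromB → IsBase M ra A∩B
  A∩B-isBase reach = (λ x → proj₁ ∘ to (∈-A∩B⇔ x)) , base
    where
      base : ∀ v → Vertex M ra v → Σ (Fin size) λ b → b ∈ₛ A∩B × Reachable M ra b v
      base v v∈A with reach v v∈A
      ... | b , b∈B , b⇝v@(b∈A , _) = b , from (∈-A∩B⇔ b) (b∈A , b∈B) , b⇝v

  valD≡0⇔reachableFromB : ∀ φ f → UsefulLabeling M ra φ f → ValD≡ M ra f 0 ⇔ ReachableFromB
  valD≡0⇔reachableFromB φ f U = mk⇔ reachable valD≡0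
    where
      f-positive : ∀ u → Vertex M ra u → 1 ≤ f u
      f-positive u u∈A = proj₁ (UsefulLabeling.range U u u∈A)

      reachable : ValD≡ M ra f 0 → ReachableFromB
      reachable ((X , (X⊆A , X-base) , val≡0) , _) v v∈A with X-base v v∈A
      ... | x , x∈X , x⇝v = x , val≡0⇒⊆B f X f-positive X⊆A val≡0 x x∈X , x⇝v

      valD≡0 : ReachableFromB → ValD≡ M ra f 0
      valD≡0 reach =
        (A∩B , A∩B-isBase reach , val-⊆B≡0 f A∩B (λ x → proj₂ ∘ to (∈-A∩B⇔ x))) , λ _ _ → z≤n

lemma5 : (Φ : ALCQIObRe) (M : Structure)
         (h′ : Fin (length (ALCQIObRe.RE Φ)))
         (f : Fin (Structure.size M) → ℕ) →
         let ra = lookup (ALCQIObRe.RE Φ) h′ in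
         UsefulLabeling M ra (ALCQIObRe.φ Φ) f →
         ValD≡ M ra f 0 ⇔
           (∀ v → Vertex M ra v →
              Σ (Fin (Structure.size M)) λ b → InB M ra b × Reachable M ra b v)
lemma5 Φ M h′ f = valD≡0⇔reachableFromB M (lookup (ALCQIObRe.RE Φ) h′) (ALCQIObRe.φ Φ) f
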